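{- If $G$ and $H$ are finite connected graphs, then $\sigma(G \,\Box\, H) \leq \sigma(G) + \sigma(H)$, where $G \,\Box\, H$ is the Cartesian product.
   Context: Surrounding Cops and Robbers on a finite simple graph $G$ with $k \geq 1$ cops and one robber: the cops first choose starting vertices (several cops may share a vertex), then the robber chooses a starting vertex not occupied by a cop, and thereafter the cops and the robber alternate moves, the cops moving first. In a move, each player may move to an adjacent vertex or stay put; the robber may never move to, or remain on, a vertex occupied by a cop, so if a cop moves onto the robber's vertex the robber is compelled to move to a neighbouring vertex not occupied by a cop. The cops win if at any time every neighbour of the robber's vertex is occupied by a cop; the robber wins if he avoids this forever. Play is with perfect information. The surrounding cop number $\sigma(G)$ is the least number of cops for which the cops have a winning strategy. The Cartesian product $G \,\Box\, H$ has vertex set $V(G)\times V(H)$, with $(g,h)$ adjacent to $(g',h')$ iff either $g=g'$ and $hh' \in E(H)$, or $h=h'$ and $gg'\in E(G)$. -}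

module Defs where

open import Data.Nat using (ℕ; _*_; _+_; _≤_; _<_)
open import Data.Fin using (Fin)
open import Data.Fin.Properties using (*↔×)
open import Data.Product using (Σ; ∃; _×_; _,_; proj₁; proj₂)
open import Data.Sum using (_⊎_; inj₁; inj₂)
open import Data.Empty using (⊥)
open import Relation.Nullary using (¬_; Dec; yes; no)
open import Relation.Binary.PropositionalEquality using (_≡_; _≢_; refl; sym; trans; cong)
open import Function.Bundles using (_↔_)
open import Function.Properties.Inverse using (↔-trans; ↔-sym)
open import Data.Product.Function.NonDependent.Propositional using (_×-↔_)

record Graph : Set₁ where
  field
    V       : Set
    size    : ℕ
    enum    : V ↔ Fin size
    _~_     : V → V → Set
    ~-dec   : ∀ u v → Dec (u ~ v)
    ~-sym   : ∀ {u v} → u ~ v → v ~ u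
    ~-irrefl : ∀ {v} → ¬ (v ~ v)

open Graph public

enum-inj : (G : Graph) → ∀ {a b : V G} →
  Function.Bundles.Inverse.to (enum G) a ≡ Function.Bundles.Inverse.to (enum G) b → a ≡ b
enum-inj G {a} {b} p = trans (sym (inv a)) (trans (cong (Function.Bundles.Inverse.from (enum G)) p) (inv b))
  where inv = Function.Bundles.Inverse.strictlyInverseʳ (enum G)

data Reach (G : Graph) : V G → V G → Set where
  here : ∀ {u} → Reach G u u
  step : ∀ {u v w} → _~_ G u v → Reach G v w → Reach G u w

Connected : Graph → Set
Connected G = ∀ u v → Reach G u v

module _ (G H : Graph) where
  data ProdAdj : V G × V H → V G × V H → Set where
    left  : ∀ {g g' h} → _~_ G g g' → ProdAdj (g , h) (g' , h)
    right : ∀ {g h h'} → _~_ H h h' → ProdAdj (g , h) (g , h')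

  private
    dec≡G : ∀ (a b : V G) → Dec (a ≡ b)
    dec≡G a b with Data.Fin._≟_ (Function.Bundles.Inverse.to (enum G) a) (Function.Bundles.Inverse.to (enum G) b)
    ... | yes p = yes (enum-inj G p)
    ... | no ¬p = no λ { refl → ¬p refl }
    dec≡H : ∀ (a b : V H) → Dec (a ≡ b)
    dec≡H a b with Data.Fin._≟_ (Function.Bundles.Inverse.to (enum H) a) (Function.Bundles.Inverse.to (enum H) b)
    ... | yes p = yes (enum-inj H p)
    ... | no ¬p = no λ { refl → ¬p refl }

  prodAdj-dec : ∀ u v → Dec (ProdAdj u v)
  prodAdj-dec (g , h) (g' , h') with dec≡G g g' | dec≡H h h'
  ... | yes refl | yes refl = no λ { (left a) → ~-irrefl G a ; (right a) → ~-irrefl H a }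
  ... | yes refl | no h≢ with ~-dec H h h'
  ...   | yes a = yes (right a)
  ...   | no ¬a = no λ { (left a) → ~-irrefl G a ; (right a) → ¬a a }
  prodAdj-dec (g , h) (g' , h') | no g≢ | yes refl with ~-dec G g g'
  ...   | yes a = yes (left a)
  ...   | no ¬a = no λ { (left a) → ¬a a ; (right a) → g≢ refl }
  prodAdj-dec (g , h) (g' , h') | no g≢ | no h≢ =
    no λ { (left a) → h≢ refl ; (right a) → g≢ refl }

  prodAdj-sym : ∀ {u v} → ProdAdj u v → ProdAdj v u
  prodAdj-sym (left a)  = left (~-sym G a)
  prodAdj-sym (right a) = right (~-sym H a)

  prodAdj-irrefl : ∀ {v} → ¬ ProdAdj v v
  prodAdj-irrefl (left a)  = ~-irrefl G a
  prodAdj-irrefl (right a) = ~-irrefl H a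

  _□_ : Graph
  _□_ = record
    { V        = V G × V H
    ; size     = size G * size H
    ; enum     = ↔-trans (enum G ×-↔ enum H) (↔-sym *↔×)
    ; _~_      = ProdAdj
    ; ~-dec    = prodAdj-dec
    ; ~-sym    = prodAdj-sym
    ; ~-irrefl = prodAdj-irrefl
    }

module Game (G : Graph) (k : ℕ) where
  Cops : Set
  Cops = Fin k → V G

  Step : V G → V G → Set
  Step u v = (u ≡ v) ⊎ _~_ G u v

  Surrounded : Cops → V G → Set
  Surrounded c r = ∀ v → _~_ G r v → Σ (Fin k) λ i → c i ≡ v

  Free : Cops → V G → Set
  Free c v = ∀ i → c i ≢ v

  -- Winning strategies for the cops, as well-founded strategy trees
  -- (the cops must surround the robber after finitely many moves).
  data CopTurn (c : Cops) (r : V G) : Set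
  data RobTurn (c : Cops) (r : V G) : Set

  -- cops to move; robber at r (not on a cop)
  data CopTurn c r where
    surr : Surrounded c r → CopTurn c r
    move : (c' : Cops) → (∀ i → Step (c i) (c' i)) → RobTurn c' r → CopTurn c r

  -- robber to move (a cop may have stepped onto r)
  data RobTurn c r where
    surr : Surrounded c r → RobTurn c r
    move : (∀ r' → Step r r' → Free c r' → CopTurn c r') → RobTurn c r

  -- k cops have a winning strategy: choose starting positions so that
  -- for every legal robber start the cops (moving first) win
  CopsWin : Set
  CopsWin = Σ Cops λ c → ∀ r → Free c r → CopTurn c r

open Game public using (CopsWin)

-- s is the surrounding cop number σ(G) (cop numbers range over k ≥ 1)
IsSigma : Graph → ℕ → Set
IsSigma G s = (1 ≤ s) × CopsWin G s × (∀ m → 1 ≤ m → m < s → ¬ CopsWin G m)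

module Submission where

-- Given winning strategies for a cops on G and b cops on H, the a + b cops on
-- G □ H split into two teams.  Team A plays the G-strategy inside the
-- robber's H-fibre: it first walks along H (connectivity) into the robber's
-- current fibre, copying every H-move he makes, and then answers each of his
-- G-moves (or stays) as the G-strategy prescribes while copying his H-moves.
-- Team B does the same with the roles of G and H exchanged.  When team A
-- guards all G-neighbours and team B all H-neighbours of the robber, he is
-- surrounded in G □ H.  Termination: each team's progress is a well-founded
-- rank (height of its strategy tree plus the walk still to go).  A G-move of
-- the robber lowers team A's rank and keeps team B's, an H-move the converse,
-- and staying lowers the rank of each team not yet guarding him.

open import Defs
open import Data.Nat using (ℕ; zero; suc; _+_; _≤_)
open import Data.Nat.Properties using (≤-refl; ≤-trans; m≤m+n)
open import Data.Product using (Σ; _×_; _,_; proj₁; proj₂)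
open import Data.Sum using (_⊎_; inj₁; inj₂)
open import Data.Empty using (⊥; ⊥-elim)
open import Data.Unit using (⊤; tt)
open import Data.Fin using (Fin; _↑ˡ_; _↑ʳ_; splitAt; fromℕ<)
open import Data.Vec.Functional using (_++_)
open import Data.Vec.Functional.Properties using (lookup-++ˡ; lookup-++ʳ)
open import Relation.Binary.PropositionalEquality using (_≡_; refl; cong; trans)
open import Induction.WellFounded using (Acc; acc)

-- Ranks: well-founded trees with arbitrary branching, ordered by "is an
-- immediate subtree of".  They measure the remaining length of a strategy.
data Rank : Set₁ where
  rk : {I : Set} → (I → Rank) → Rank

data _<R_ : Rank → Rank → Set₁ where
  child : ∀ {I : Set} {ch : I → Rank} (i : I) → ch i <R rk ch

<R-wellFounded : ∀ r → Acc _<R_ r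
<R-wellFounded (rk ch) = acc λ { (child i) → <R-wellFounded (ch i) }

rank₀ : Rank
rank₀ = rk {⊥} λ ()

-- The length is what stays invariant when a walking
-- team follows the robber: extending the walk by his move and removing its
-- first step (taken by the team) leaves it unchanged.
data Walk (Y : Graph) : ℕ → V Y → V Y → Set where
  here : ∀ {u} → Walk Y zero u u
  step : ∀ {n u v w} → _~_ Y u v → Walk Y n v w → Walk Y (suc n) u w

snoc : ∀ {Y n u v w} → Walk Y n u v → _~_ Y v w → Walk Y (suc n) u w
snoc here e       = step e here
snoc (step e w) f = step e (snoc w f)

reach⇒walk : ∀ {Y u v} → Reach Y u v → Σ ℕ λ n → Walk Y n u v
reach⇒walk here       = zero , here
reach⇒walk (step e p) = suc (proj₁ (reach⇒walk p)) , step e (proj₂ (reach⇒walk p))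

-- One team of k cops shadowing the robber in a graph Z into which X □ Y
-- maps by an adjacency-preserving emb (no injectivity needed): the team plays a winning X-strategy (c₀, win) on the
-- X-coordinate while tracking the robber's Y-coordinate.  The robber is at
-- emb x y; his own moves change x, his other moves change y.
module Shadow (X Y Z : Graph) (emb : V X → V Y → V Z)
  (emb-own : ∀ {x x' y} → _~_ X x x' → _~_ Z (emb x y) (emb x' y))
  (emb-other : ∀ {x y y'} → _~_ Y y y' → _~_ Z (emb x y) (emb x y'))
  (k : ℕ) (c₀ : Fin k → V X)
  (win : ∀ x → Game.Free X k c₀ x → Game.CopTurn X k c₀ x) where

  open Game X k

  Team : Set
  Team = Fin k → V Z

  _at_ : Cops → V Y → Team
  (c at y) i = emb (c i) y

  Moves : Team → Team → Set
  Moves p p' = ∀ i → Game.Step Z k (p i) (p' i)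

  stay : ∀ {p} → Moves p p
  stay i = inj₁ refl

  inFibre : ∀ {x x' y} → Step x x' → Game.Step Z k (emb x y) (emb x' y)
  inFibre (inj₁ refl) = inj₁ refl
  inFibre (inj₂ e)    = inj₂ (emb-own e)

  followOther : ∀ {c y y'} → _~_ Y y y' → Moves (c at y) (c at y')
  followOther e i = inj₂ (emb-other e)

  unfibre : ∀ {c x y} → Game.Free Z k (c at y) (emb x y) → Free c x
  unfibre {y = y} fr i eq = fr i (cong (λ z → emb z y) eq)

  Guards : Team → V X → V Y → Set
  Guards p x y = ∀ x' → _~_ X x x' → Σ (Fin k) λ i → p i ≡ emb x' y

  guards : ∀ {c x y} → Surrounded c x → Guards (c at y) x y
  guards {y = y} s x' e = proj₁ (s x' e) , cong (λ z → emb z y) (proj₂ (s x' e))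

  rankC : ∀ {c x} → CopTurn c x → Rank
  rankR : ∀ {c x} → RobTurn c x → Rank
  rankC (surr _)     = rank₀
  rankC (move _ _ t) = rankR t
  rankR (surr _) = rank₀
  rankR {c} {x} (move f) = rk {Σ (V X) λ x' → Step x x' × Free c x'}
    λ m → rankC (f (proj₁ m) (proj₁ (proj₂ m)) (proj₂ (proj₂ m)))

  rankWalk : ℕ → Rank
  rankWalk zero    = rk {Σ (V X) (Free c₀)} λ m → rankC (win (proj₁ m) (proj₂ m))
  rankWalk (suc n) = rk {⊤} λ _ → rankWalk n

  -- Plan r x y p: with the robber to move at emb x y and the team at p, the
  -- team is either still walking towards his fibre or playing a strategy
  -- tree in it; r is the rank of what remains.
  data Plan : Rank → V X → V Y → Team → Set₁ where
    walking : ∀ {n x y y₀} → Walk Y n y₀ y → Plan (rankWalk n) x y (c₀ at y₀)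
    playing : ∀ {c x y} (t : RobTurn c x) → Plan (rankR t) x y (c at y)

  Advance : Rank → V X → V Y → Team → Set₁
  Advance r x y p = Σ Team λ p' → Moves p p' × Σ Rank λ r' → (r' <R r) × Plan r' x y p'

  Follow : Rank → V X → V Y → Team → Set₁
  Follow r x y p = Σ Team λ p' → Moves p p' × Plan r x y p'

  answer : ∀ {c x y r} (ct : CopTurn c x) → rankC ct <R r → Advance r x y (c at y)
  answer (surr s)      lt = _ , stay , _ , lt , playing (surr s)
  answer (move _ st t)  lt = _ , (λ i → inFibre (st i)) , _ , lt , playing t

  walkOn : ∀ {n x y y₀} → Walk Y n y₀ y → Game.Free Z k (c₀ at y₀) (emb x y) →
    Advance (rankWalk n) x y (c₀ at y₀)
  walkOn {x = x} here fr = answer (win x (unfibre fr)) (child (x , unfibre fr))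
  walkOn (step e w) fr   = _ , followOther e , _ , child tt , walking w

  respond : ∀ {c x x' y} (f : ∀ x' → Step x x' → Free c x' → CopTurn c x')
    (st : Step x x') → Game.Free Z k (c at y) (emb x' y) → Advance (rankR (move f)) x' y (c at y)
  respond {x' = x'} f st fr = answer (f x' st (unfibre fr)) (child (x' , st , unfibre fr))

  -- The robber moves along X: the team advances.  (A surrounded tree is
  -- impossible here, since he cannot step onto a guarded neighbour.)
  onOwnMove : ∀ {r x x' y p} → Plan r x y p → _~_ X x x' →
    Game.Free Z k p (emb x' y) → Advance r x' y p
  onOwnMove (walking w)        _ fr = walkOn w fr
  onOwnMove {y = y} (playing (surr s)) e fr with guards {y = y} s _ e
  ... | i , occupied = ⊥-elim (fr i occupied)
  onOwnMove (playing (move f)) e fr = respond f (inj₂ e) fr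

  onOtherMove : ∀ {r x y y' p} → Plan r x y p → _~_ Y y y' → Follow r x y' p
  onOtherMove (walking w) e with snoc w e
  ... | step e₀ w' = _ , followOther e₀ , walking w'
  onOtherMove (playing t) e = _ , followOther e , playing t

  onStay : ∀ {r x y p} → Plan r x y p → Game.Free Z k p (emb x y) →
    Guards p x y ⊎ Advance r x y p
  onStay (walking w)        fr = inj₂ (walkOn w fr)
  onStay (playing (surr s)) _  = inj₁ (guards s)
  onStay (playing (move f)) fr = inj₂ (respond f (inj₁ refl) fr)

module Product (G H : Graph) (a b : ℕ)
  (cA : Fin a → V G) (winA : ∀ g → Game.Free G a cA g → Game.CopTurn G a cA g)
  (cB : Fin b → V H) (winB : ∀ h → Game.Free H b cB h → Game.CopTurn H b cB h) where

  module A = Shadow G H (G □ H) _,_ left right a cA winA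
  module B = Shadow H G (G □ H) (λ h g → g , h) right left b cB winB

  open Game (G □ H) (a + b) hiding (CopsWin)

  joinMoves : ∀ {pA pA' pB pB'} → A.Moves pA pA' → B.Moves pB pB' →
    ∀ i → Step ((pA ++ pB) i) ((pA' ++ pB') i)
  joinMoves mA mB i with splitAt a i
  ... | inj₁ j = mA j
  ... | inj₂ j = mB j

  freeA : ∀ {pA pB r} → Free (pA ++ pB) r → Game.Free (G □ H) a pA r
  freeA {pA} {pB} fr i eq = fr (i ↑ˡ b) (trans (lookup-++ˡ pA pB i) eq)

  freeB : ∀ {pA pB r} → Free (pA ++ pB) r → Game.Free (G □ H) b pB r
  freeB {pA} {pB} fr j eq = fr (a ↑ʳ j) (trans (lookup-++ʳ pA pB j) eq)

  surrounded : ∀ {pA pB g h} → A.Guards pA g h → B.Guards pB h g → Surrounded (pA ++ pB) (g , h)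
  surrounded {pA} {pB} gA gB _ (left e)  =
    proj₁ (gA _ e) ↑ˡ b , trans (lookup-++ˡ pA pB _) (proj₂ (gA _ e))
  surrounded {pA} {pB} gA gB _ (right e) =
    a ↑ʳ proj₁ (gB _ e) , trans (lookup-++ʳ pA pB _) (proj₂ (gB _ e))

  -- The robber to move at (g , h) against plans of both teams; the
  -- accessibility of the two ranks drives the recursion.
  chase : ∀ {ra rb g h pA pB} → Acc _<R_ ra → Acc _<R_ rb →
    A.Plan ra g h pA → B.Plan rb h g pB → RobTurn (pA ++ pB) (g , h)

  continue : ∀ {ra rb g h pA pA' pB pB'} → Acc _<R_ ra → Acc _<R_ rb →
    A.Moves pA pA' → B.Moves pB pB' → A.Plan ra g h pA' → B.Plan rb h g pB' →
    CopTurn (pA ++ pB) (g , h)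
  continue accA accB mA mB sa sb = move _ (joinMoves mA mB) (chase accA accB sa sb)

  reply : ∀ {ra rb g h pA pB} → Acc _<R_ ra → Acc _<R_ rb →
    A.Plan ra g h pA → B.Plan rb h g pB →
    ∀ r' → Step (g , h) r' → Free (pA ++ pB) r' → CopTurn (pA ++ pB) r'
  reply accA@(acc <A) accB@(acc <B) sa sb _ (inj₁ refl) fr
    with A.onStay sa (freeA fr) | B.onStay sb (freeB fr)
  ... | inj₁ gA | inj₁ gB = surr (surrounded gA gB)
  ... | inj₁ _ | inj₂ (_ , mB , _ , ltB , sb') = continue accA (<B ltB) A.stay mB sa sb'
  ... | inj₂ (_ , mA , _ , ltA , sa') | inj₁ _ = continue (<A ltA) accB mA B.stay sa' sb
  ... | inj₂ (_ , mA , _ , ltA , sa') | inj₂ (_ , mB , _ , ltB , sb') =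
    continue (<A ltA) (<B ltB) mA mB sa' sb'
  reply (acc <A) accB sa sb _ (inj₂ (left e)) fr
    with A.onOwnMove sa e (freeA fr) | B.onOtherMove sb e
  ... | _ , mA , _ , ltA , sa' | _ , mB , sb' = continue (<A ltA) accB mA mB sa' sb'
  reply accA (acc <B) sa sb _ (inj₂ (right e)) fr
    with A.onOtherMove sa e | B.onOwnMove sb e (freeB fr)
  ... | _ , mA , sa' | _ , mB , _ , ltB , sb' = continue accA (<B ltB) mA mB sa' sb'

  chase accA accB sa sb = move (reply accA accB sa sb)

  copsWin : V G → V H → Connected G → Connected H → CopsWin (G □ H) (a + b)
  copsWin g₀ h₀ cG cH = start , λ { (g , h) _ →
      move start (joinMoves A.stay B.stay) (chase (<R-wellFounded _) (<R-wellFounded _)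
        (A.walking {x = g} (proj₂ (reach⇒walk (cH h₀ h))))
        (B.walking {x = h} (proj₂ (reach⇒walk (cG g₀ g))))) }
    where
      start : Cops
      start = (cA A.at h₀) ++ (cB B.at g₀)

-- σ(G) + σ(H) cops suffice: combine the two optimal strategies; as a, b ≥ 1,
-- the first cop of each provides a starting vertex of G and of H.
theorem16 : (G H : Graph) → Connected G → Connected H →
    (a b : ℕ) → IsSigma G a → IsSigma H b →
    Σ ℕ (λ m → (1 ≤ m) × (m ≤ a + b) × CopsWin (G □ H) m)
theorem16 G H cG cH a b (1≤a , (cA , winA) , _) (1≤b , (cB , winB) , _) =
  a + b , ≤-trans 1≤a (m≤m+n a b) , ≤-refl ,
  Product.copsWin G H a b cA winA cB winB (cA (fromℕ< 1≤a)) (cB (fromℕ< 1≤b)) cG cH
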